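{- Let $\mathcal{C}$ be an $[N,K,D]_{q^h}$ code and $W:=\max_{c\in\mathcal{C}}\mathrm{wt}(c)$. If \[\frac{W}{D}<\frac{q}{q-1},\] then $\mathcal{C}$ is outer minimal.
   Context: $\mathrm{wt}(c)$ is the Hamming weight, $D$ the minimum Hamming distance of $\mathcal{C}$. An $[N,K]_{q^h}$ code $\mathcal{C}$ is outer minimal if the concatenated code $\{(\pi(c_1),\dots,\pi(c_N)):c\in\mathcal{C}\}$ over $\mathbb{F}_q$ is minimal, where $\pi:\mathbb{F}_{q^h}\to\mathbb{F}_q^{(q^h-1)/(q-1)}$ is an injective $\mathbb{F}_q$-linear map whose image is the simplex code $\mathcal{S}_q(h)$ (generated by a matrix whose columns are one nonzero representative of each $1$-dimensional subspace of $\mathbb{F}_q^h$). A linear code is minimal if for any two nonzero codewords $v,v'$ with $\sigma(v')\subseteq\sigma(v)$ (supports), $v'$ is a scalar multiple of $v$. -}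

module Defs where

open import Level using (0ℓ)
open import Algebra.Bundles using (CommutativeRing)
open import Algebra.Morphism.Structures using (module RingMorphisms)
open import Data.Nat using (ℕ; zero; suc)
open import Data.Fin using (Fin)
open import Data.Product using (Σ; ∃; _×_; _,_)
open import Data.List using (List; length; filter; allFin)
open import Data.Vec.Functional using (foldr)
open import Relation.Nullary using (¬_; Dec)
open import Relation.Binary.PropositionalEquality using (_≡_)
open import Relation.Binary using (Decidable)

record Field : Set₁ where
  field
    commutativeRing : CommutativeRing 0ℓ 0ℓ
  open CommutativeRing commutativeRing public
  field
    0≉1     : ¬ (0# ≈ 1#)
    inverse : ∀ x → ¬ (x ≈ 0#) → Σ Carrier (λ y → x * y ≈ 1#)

record HasSize (F : Field) (q : ℕ) : Set where
  open Field F
  field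
    enum      : Fin q → Carrier
    enum-inj  : ∀ i j → enum i ≈ enum j → i ≡ j
    enum-surj : ∀ x → ∃ λ i → enum i ≈ x

module _ (F : Field) where
  open Field F

  Σ[_] : ∀ {n} → (Fin n → Carrier) → Carrier
  Σ[ v ] = foldr _+_ 0# v

record Extension (K E : Field) (h : ℕ) : Set where
  module K = Field K
  module E = Field E
  open RingMorphisms (CommutativeRing.rawRing K.commutativeRing)
                     (CommutativeRing.rawRing E.commutativeRing)
  field
    ι       : K.Carrier → E.Carrier
    ι-hom   : IsRingHomomorphism ι
    basis   : Fin h → E.Carrier
    spans   : ∀ (e : E.Carrier) → ∃ λ (a : Fin h → K.Carrier) →
                e E.≈ Σ[ E ] (λ i → ι (a i) E.* basis i)
    indep   : ∀ (a a' : Fin h → K.Carrier) →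
                Σ[ E ] (λ i → ι (a i) E.* basis i) E.≈ Σ[ E ] (λ i → ι (a' i) E.* basis i) →
                ∀ i → a i K.≈ a' i

module _ (F : Field) where
  open Field F

  Word : Set → Set
  Word I = I → Carrier

  record IsLinearCode {I : Set} (C : Word I → Set) : Set where
    field
      resp  : ∀ {c c'} → (∀ i → c i ≈ c' i) → C c → C c'
      zero∈ : C (λ _ → 0#)
      +∈    : ∀ {c c'} → C c → C c' → C (λ i → c i + c' i)
      ·∈    : ∀ a {c} → C c → C (λ i → a * c i)

  _⊆supp_ : ∀ {I} → Word I → Word I → Set
  v' ⊆supp v = ∀ i → ¬ (v' i ≈ 0#) → ¬ (v i ≈ 0#)

  NonZero : ∀ {I} → Word I → Set
  NonZero v = ∃ λ i → ¬ (v i ≈ 0#)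

  Minimal : ∀ {I} → (Word I → Set) → Set
  Minimal C = ∀ v v' → C v → C v' → NonZero v → NonZero v' →
              v' ⊆supp v → ∃ λ (a : Carrier) → ∀ i → v' i ≈ a * v i

  module Hamming (_≟_ : Decidable _≈_) where
    dist : ∀ {n} → Word (Fin n) → Word (Fin n) → ℕ
    dist c c' = length (filter (λ i → Relation.Nullary.¬? (c i ≟ c' i)) (allFin _))

    wt : ∀ {n} → Word (Fin n) → ℕ
    wt c = dist c (λ _ → 0#)

module _ (K : Field) where
  open Field K

  record IsRepresentativeSystem (h M : ℕ) (g : Fin M → Fin h → Carrier) : Set where
    field
      nonzero  : ∀ j → ∃ λ i → ¬ (g j i ≈ 0#)
      distinct : ∀ j k (a : Carrier) → (∀ i → g k i ≈ a * g j i) → j ≡ k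
      covers   : ∀ (x : Fin h → Carrier) → (∃ λ i → ¬ (x i ≈ 0#)) →
                 ∃ λ j → ∃ λ (a : Carrier) → ∀ i → x i ≈ a * g j i

  SimplexCode : ∀ {h M} → (Fin M → Fin h → Carrier) → (Fin M → Carrier) → Set
  SimplexCode {h} g w = ∃ λ (x : Fin h → Carrier) → ∀ j → w j ≈ Σ[ K ] (λ i → x i * g j i)

module _ {K E : Field} {h : ℕ} (ext : Extension K E h) where
  open Extension ext

  record IsSimplexEmbedding {M : ℕ} (g : Fin M → Fin h → K.Carrier)
                            (π : E.Carrier → Fin M → K.Carrier) : Set where
    field
      π-resp : ∀ {e e'} → e E.≈ e' → ∀ j → π e j K.≈ π e' j
      π-+    : ∀ e e' j → π (e E.+ e') j K.≈ (π e j K.+ π e' j)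
      π-·    : ∀ a e j → π (ι a E.* e) j K.≈ (a K.* π e j)
      π-inj  : ∀ e e' → (∀ j → π e j K.≈ π e' j) → e E.≈ e'
      π-into : ∀ e → SimplexCode K g (π e)
      π-onto : ∀ w → SimplexCode K g w → ∃ λ e → ∀ j → π e j K.≈ w j

  Concatenated : ∀ {N M} → (E.Carrier → Fin M → K.Carrier) →
                 (Word E (Fin N) → Set) → Word K (Fin N × Fin M) → Set
  Concatenated π C v = ∃ λ c → C c × (∀ i j → v (i , j) K.≈ π (c i) j)

  OuterMinimal : ∀ {N} → (Word E (Fin N) → Set) → Set
  OuterMinimal C = ∀ (M : ℕ) (g : Fin M → Fin h → K.Carrier)
                     (π : E.Carrier → Fin M → K.Carrier) →
                   IsRepresentativeSystem K h M g →
                   IsSimplexEmbedding g π →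
                   Minimal K (Concatenated π C)

-- The simplex code is minimal in a strong sense: if the support of π y lies inside that of
-- π x, then y is a K-multiple of x. Otherwise the coordinate vectors X, Y ∈ Kʰ of π x, π y
-- have a nonzero 2×2 minor X k Y l − X l Y k; the functional U ↦ X k U l − X l U k kills X
-- but not Y, and being a multiple of some representative g j it exhibits a coordinate j
-- where π y is nonzero and π x vanishes.
--
-- Hence a support inclusion in the concatenated code forces c' i = a i · c i coordinatewise
-- with a i ∈ K. If c' were no single K-multiple of c, the q codewords b·c − c' (b ∈ K)
-- would all be nonzero, so q·D ≤ Σ_b wt(b·c − c'). Each coordinate with c i ≠ 0 vanishes
-- for exactly one b, so that sum is (q − 1)·wt c ≤ (q − 1)·W, contradicting W(q − 1) < qD.

module Submission where

open import Algebra.Bundles using (CommutativeRing)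
open import Algebra.Morphism.Structures using (module RingMorphisms)
open import Data.Bool using (true; false)
open import Data.Empty using (⊥-elim)
open import Data.Fin as Fin using (Fin; zero; suc)
open import Data.Fin.Properties using (any?; all?; ¬∀⟶∃¬; punchInᵢ≢i)
open import Data.List using (length; filter; tabulate)
open import Data.Nat using (ℕ; zero; suc)
open import Data.Product using (∃; _×_; _,_; proj₂)
open import Data.Vec.Functional using (Vector; removeAt)
open import Function using (_∘_)
open import Relation.Binary using (Decidable)
open import Relation.Binary.PropositionalEquality as ≡ using (_≡_; _≢_)
open import Relation.Nullary using (¬_; Dec; yes; no; ¬?; _because_)
open import Relation.Nullary.Decidable using (decidable-stable)
open import Relation.Unary as U using (Pred)

open import Defs

module FieldProperties (F : Field) where
  open Field F hiding (zero)
  open import Algebra.Properties.Group +-group public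
    using (x∙y⁻¹≈ε⇒x≈y; x≈y⇒x∙y⁻¹≈ε)
  open import Algebra.Properties.Ring ring public
    using (-1*x≈-x; -‿distribˡ-*)
  open import Algebra.Properties.CommutativeSemigroup *-commutativeSemigroup public
    using (x∙yz≈y∙xz)
  open import Algebra.Properties.Semiring.Sum semiring public
  open import Relation.Binary.Reasoning.Setoid setoid

  x≉0∧x*y≈0⇒y≈0 : ∀ {x y} → x ≉ 0# → x * y ≈ 0# → y ≈ 0#
  x≉0∧x*y≈0⇒y≈0 {x} {y} x≉0 xy≈0 with inverse x x≉0
  ... | x⁻¹ , xx⁻¹≈1 = begin
    y                ≈⟨ *-identityˡ y ⟨
    1# * y           ≈⟨ *-congʳ (trans (*-comm x⁻¹ x) xx⁻¹≈1) ⟨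
    x⁻¹ * x * y      ≈⟨ *-assoc x⁻¹ x y ⟩
    x⁻¹ * (x * y)    ≈⟨ *-congˡ xy≈0 ⟩
    x⁻¹ * 0#         ≈⟨ zeroʳ x⁻¹ ⟩
    0#               ∎

  δ : ∀ {n} → Fin n → Vector Carrier n
  δ zero    zero    = 1#
  δ zero    (suc _) = 0#
  δ (suc _) zero    = 0#
  δ (suc l) (suc i) = δ l i

  ⟨_,_⟩ : ∀ {n} → Vector Carrier n → Vector Carrier n → Carrier
  ⟨ U , V ⟩ = Σ[ F ] (λ i → U i * V i)

  ⟨,⟩-zeroˡ : ∀ {n} {U V : Vector Carrier n} → (∀ i → U i ≈ 0#) → ⟨ U , V ⟩ ≈ 0#
  ⟨,⟩-zeroˡ {n} {V = V} U≈0 =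
    trans (sum-cong-≋ {n} (λ i → trans (*-congʳ (U≈0 i)) (zeroˡ (V i)))) (sum-replicate-zero n)

  ⟨,⟩-zeroʳ : ∀ {n} {U V : Vector Carrier n} → (∀ i → V i ≈ 0#) → ⟨ U , V ⟩ ≈ 0#
  ⟨,⟩-zeroʳ {n} {U} V≈0 =
    trans (sum-cong-≋ {n} (λ i → trans (*-congˡ (V≈0 i)) (zeroʳ (U i)))) (sum-replicate-zero n)

  ⟨,⟩-scaleˡ : ∀ {n} {U U' V : Vector Carrier n} a → (∀ i → U i ≈ a * U' i) →
               ⟨ U , V ⟩ ≈ a * ⟨ U' , V ⟩
  ⟨,⟩-scaleˡ {n} {U' = U'} {V} a U≈aU' = trans
    (sum-cong-≋ {n} (λ i → trans (*-congʳ (U≈aU' i)) (*-assoc a (U' i) (V i))))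
    (sym (*-distribˡ-sum a (λ i → U' i * V i)))

  ⟨,⟩-scaleʳ : ∀ {n} {U V V' : Vector Carrier n} b → (∀ i → V i ≈ b * V' i) →
               ⟨ U , V ⟩ ≈ b * ⟨ U , V' ⟩
  ⟨,⟩-scaleʳ {n} {U = U} {V' = V'} b V≈bV' = trans
    (sum-cong-≋ {n} (λ i → trans (*-congˡ (V≈bV' i)) (x∙yz≈y∙xz (U i) b (V' i))))
    (sym (*-distribˡ-sum b (λ i → U i * V' i)))

  ⟨,⟩-linearʳ : ∀ {n} (U V V' : Vector Carrier n) a b →
                ⟨ U , (λ i → a * V i + b * V' i) ⟩ ≈ a * ⟨ U , V ⟩ + b * ⟨ U , V' ⟩
  ⟨,⟩-linearʳ {n} U V V' a b = begin
    ⟨ U , (λ i → a * V i + b * V' i) ⟩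
      ≈⟨ sum-cong-≋ {n} (λ i → trans (distribˡ (U i) _ _)
           (+-cong (x∙yz≈y∙xz (U i) a (V i)) (x∙yz≈y∙xz (U i) b (V' i)))) ⟩
    sum (λ i → a * (U i * V i) + b * (U i * V' i))
      ≈⟨ ∑-distrib-+ (λ i → a * (U i * V i)) (λ i → b * (U i * V' i)) ⟩
    sum (λ i → a * (U i * V i)) + sum (λ i → b * (U i * V' i))
      ≈⟨ +-cong (*-distribˡ-sum a (λ i → U i * V i)) (*-distribˡ-sum b (λ i → U i * V' i)) ⟨
    a * ⟨ U , V ⟩ + b * ⟨ U , V' ⟩ ∎

  ⟨,δ⟩ : ∀ {n} (U : Vector Carrier n) l → ⟨ U , δ l ⟩ ≈ U l
  ⟨,δ⟩ U zero    = trans (+-cong (*-identityʳ (U zero)) (⟨,⟩-zeroʳ {U = U ∘ suc} (λ _ → refl)))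
                         (+-identityʳ (U zero))
  ⟨,δ⟩ U (suc l) = trans (+-cong (zeroʳ (U zero)) (⟨,δ⟩ (U ∘ suc) l))
                         (+-identityˡ (U (suc l)))

  cross-multiply⇒proportional : ∀ {x u y x' y'} → x * u ≈ 1# → x * y' ≈ x' * y →
                                y' ≈ (y * u) * x'
  cross-multiply⇒proportional {x} {u} {y} {x'} {y'} xu≈1 xy'≈x'y = begin
    y'               ≈⟨ *-identityˡ y' ⟨
    1# * y'          ≈⟨ *-congʳ (trans (*-comm u x) xu≈1) ⟨
    u * x * y'       ≈⟨ *-assoc u x y' ⟩
    u * (x * y')     ≈⟨ *-congˡ xy'≈x'y ⟩
    u * (x' * y)     ≈⟨ x∙yz≈y∙xz u x' y ⟩
    x' * (u * y)     ≈⟨ *-comm x' (u * y) ⟩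
    u * y * x'       ≈⟨ *-congʳ (*-comm u y) ⟩
    y * u * x'       ∎

  difference-of-multiples : ∀ {a b y z} → y ≈ a * z → b * z - y ≈ (b - a) * z
  difference-of-multiples {a} {b} {y} {z} y≈az = begin
    b * z - y         ≈⟨ +-congˡ (-‿cong y≈az) ⟩
    b * z - a * z     ≈⟨ +-congˡ (-‿distribˡ-* a z) ⟩
    b * z + - a * z   ≈⟨ distribʳ z b (- a) ⟨
    (b - a) * z       ∎

module _ {F : Field} {q : ℕ} (size : HasSize F q) where
  open Field F
  open HasSize size

  finite⇒≈-decidable : Decidable _≈_
  finite⇒≈-decidable a b with enum-surj a | enum-surj b
  ... | i , i↦a | j , j↦b with i Fin.≟ j
  ... | yes ≡.refl = yes (trans (sym i↦a) j↦b)
  ... | no i≢j = no (λ a≈b → i≢j (enum-inj i j (trans i↦a (trans a≈b (sym j↦b)))))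

module _ {K E : Field} {h : ℕ} (ext : Extension K E h) where
  open Extension ext
  open RingMorphisms (CommutativeRing.rawRing K.commutativeRing)
                     (CommutativeRing.rawRing E.commutativeRing)
  open IsRingHomomorphism ι-hom
  open FieldProperties K using (x∙y⁻¹≈ε⇒x≈y)

  ι-nonzero : ∀ {x} → x K.≉ K.0# → ι x E.≉ E.0#
  ι-nonzero {x} x≉0 ιx≈0 with K.inverse x x≉0
  ... | u , xu≈1 = E.0≉1 (begin
    E.0#             ≈⟨ E.zeroˡ (ι u) ⟨
    E.0# E.* ι u     ≈⟨ E.*-congʳ ιx≈0 ⟨
    ι x E.* ι u      ≈⟨ *-homo x u ⟨
    ι (x K.* u)      ≈⟨ ⟦⟧-cong xu≈1 ⟩
    ι K.1#           ≈⟨ 1#-homo ⟩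
    E.1#             ∎)
    where open import Relation.Binary.Reasoning.Setoid E.setoid

  ι-injective : Decidable K._≈_ → ∀ {a b} → ι a E.≈ ι b → a K.≈ b
  ι-injective _≟_ {a} {b} ιa≈ιb = decidable-stable (a ≟ b) λ a≉b →
    ι-nonzero (a≉b ∘ x∙y⁻¹≈ε⇒x≈y a b) (begin
      ι (a K.- b)            ≈⟨ +-homo a (K.- b) ⟩
      ι a E.+ ι (K.- b)      ≈⟨ E.+-congˡ (-‿homo b) ⟩
      ι a E.- ι b            ≈⟨ FieldProperties.x≈y⇒x∙y⁻¹≈ε E ιa≈ιb ⟩
      E.0#                   ∎)
    where open import Relation.Binary.Reasoning.Setoid E.setoid

module Simplex (K : Field) (_≟_ : Decidable (Field._≈_ K)) {h M : ℕ}
               {g : Fin M → Vector (Field.Carrier K) h}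
               (rep : IsRepresentativeSystem K h M g) where
  open Field K hiding (zero)
  open FieldProperties K
  open IsRepresentativeSystem rep

  nonzero-coordinateˡ : ∀ {n} {U V : Vector Carrier n} → ⟨ U , V ⟩ ≉ 0# → ∃ λ i → U i ≉ 0#
  nonzero-coordinateˡ {n} {U} ⟨U,V⟩≉0 = ¬∀⟶∃¬ n _ (λ i → U i ≟ 0#) (⟨U,V⟩≉0 ∘ ⟨,⟩-zeroˡ)

  nonzero-coordinateʳ : ∀ {n} {U V : Vector Carrier n} → ⟨ U , V ⟩ ≉ 0# → ∃ λ i → V i ≉ 0#
  nonzero-coordinateʳ {n} {V = V} ⟨U,V⟩≉0 = ¬∀⟶∃¬ n _ (λ i → V i ≟ 0#) (⟨U,V⟩≉0 ∘ ⟨,⟩-zeroʳ)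

  separating-representative : ∀ {X Y G : Vector Carrier h} → ⟨ X , G ⟩ ≈ 0# → ⟨ Y , G ⟩ ≉ 0# →
                              ∃ λ j → ⟨ Y , g j ⟩ ≉ 0# × ⟨ X , g j ⟩ ≈ 0#
  separating-representative {X} {Y} {G} ⟨X,G⟩≈0 ⟨Y,G⟩≉0
    with covers G (nonzero-coordinateʳ ⟨Y,G⟩≉0)
  ... | j , b , G≈bg = j , ⟨Y,g⟩≉0 , x≉0∧x*y≈0⇒y≈0 b≉0 (trans (sym (⟨,⟩-scaleʳ b G≈bg)) ⟨X,G⟩≈0)
    where
    ⟨Y,g⟩≉0 : ⟨ Y , g j ⟩ ≉ 0#
    ⟨Y,g⟩≉0 ⟨Y,g⟩≈0 = ⟨Y,G⟩≉0 (trans (⟨,⟩-scaleʳ b G≈bg) (trans (*-congˡ ⟨Y,g⟩≈0) (zeroʳ b)))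
    b≉0 : b ≉ 0#
    b≉0 b≈0 = ⟨Y,G⟩≉0 (trans (⟨,⟩-scaleʳ b G≈bg) (trans (*-congʳ b≈0) (zeroˡ _)))

  minor : Vector Carrier h → Fin h → Fin h → Vector Carrier h
  minor X k l i = X k * δ l i + - X l * δ k i

  ⟨,minor⟩ : ∀ U X k l → ⟨ U , minor X k l ⟩ ≈ X k * U l - X l * U k
  ⟨,minor⟩ U X k l = begin
    ⟨ U , minor X k l ⟩                    ≈⟨ ⟨,⟩-linearʳ U (δ l) (δ k) (X k) (- X l) ⟩
    X k * ⟨ U , δ l ⟩ + - X l * ⟨ U , δ k ⟩  ≈⟨ +-cong (*-congˡ (⟨,δ⟩ U l)) (*-congˡ (⟨,δ⟩ U k)) ⟩
    X k * U l + - X l * U k                ≈⟨ +-congˡ (-‿distribˡ-* (X l) (U k)) ⟨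
    X k * U l - X l * U k                  ∎
    where open import Relation.Binary.Reasoning.Setoid setoid

  ⟨self,minor⟩ : ∀ X k l → ⟨ X , minor X k l ⟩ ≈ 0#
  ⟨self,minor⟩ X k l = trans (⟨,minor⟩ X X k l) (x≈y⇒x∙y⁻¹≈ε (*-comm (X k) (X l)))

  support-inclusion⇒minors-vanish : ∀ {X Y : Vector Carrier h} →
    (∀ j → ⟨ Y , g j ⟩ ≉ 0# → ⟨ X , g j ⟩ ≉ 0#) → ∀ k l → X k * Y l ≈ X l * Y k
  support-inclusion⇒minors-vanish {X} {Y} supp k l =
    x∙y⁻¹≈ε⇒x≈y (X k * Y l) (X l * Y k) (decidable-stable ((X k * Y l - X l * Y k) ≟ 0#) λ minor≉0 →
      let j , ⟨Y,g⟩≉0 , ⟨X,g⟩≈0 = separating-representative (⟨self,minor⟩ X k l)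
                                    (minor≉0 ∘ trans (sym (⟨,minor⟩ Y X k l)))
      in supp j ⟨Y,g⟩≉0 ⟨X,g⟩≈0)

  support-inclusion⇒proportional : ∀ {X Y : Vector Carrier h} k → X k ≉ 0# →
    (∀ j → ⟨ Y , g j ⟩ ≉ 0# → ⟨ X , g j ⟩ ≉ 0#) → ∃ λ a → ∀ i → Y i ≈ a * X i
  support-inclusion⇒proportional {X} {Y} k Xk≉0 supp =
    let u , Xku≈1 = inverse (X k) Xk≉0
    in Y k * u , λ l → cross-multiply⇒proportional Xku≈1 (support-inclusion⇒minors-vanish supp k l)

module _ {K E : Field} {h M : ℕ} (ext : Extension K E h) (_≟_ : Decidable (Field._≈_ K))
         {g : Fin M → Vector (Field.Carrier K) h} {π : Field.Carrier E → Vector (Field.Carrier K) M}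
         (rep : IsRepresentativeSystem K h M g) (emb : IsSimplexEmbedding ext g π) where
  open Extension ext
  open IsSimplexEmbedding emb
  open Simplex K _≟_ rep
  open FieldProperties K using (⟨_,_⟩; ⟨,⟩-scaleˡ)

  π-support-inclusion⇒proportional : ∀ x y → (∀ j → π y j K.≉ K.0# → π x j K.≉ K.0#) →
                                     ∃ λ a → y E.≈ ι a E.* x
  π-support-inclusion⇒proportional x y supp with all? (λ j → π x j ≟ K.0#)
  ... | yes πx≈0 = K.0# , π-inj y (ι K.0# E.* x) (λ j →
    K.trans (πy≈0 j) (K.sym (K.trans (π-· K.0# x j) (K.zeroˡ (π x j)))))
    where
    πy≈0 : ∀ j → π y j K.≈ K.0#
    πy≈0 j = decidable-stable (π y j ≟ K.0#) (λ πyj≉0 → supp j πyj≉0 (πx≈0 j))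
  ... | no ¬πx≈0 =
    let j₀ , πxj₀≉0 = ¬∀⟶∃¬ M _ (λ j → π x j ≟ K.0#) ¬πx≈0
        X , πx≈⟨X,g⟩ = π-into x
        Y , πy≈⟨Y,g⟩ = π-into y
        k , Xk≉0 = nonzero-coordinateˡ (πxj₀≉0 ∘ K.trans (πx≈⟨X,g⟩ j₀))
        a , Y≈aX = support-inclusion⇒proportional k Xk≉0 λ j ⟨Y,g⟩≉0 ⟨X,g⟩≈0 →
                     supp j (⟨Y,g⟩≉0 ∘ K.trans (K.sym (πy≈⟨Y,g⟩ j))) (K.trans (πx≈⟨X,g⟩ j) ⟨X,g⟩≈0)
    in a , π-inj y (ι a E.* x) λ j → begin
      π y j             ≈⟨ πy≈⟨Y,g⟩ j ⟩
      ⟨ Y , g j ⟩       ≈⟨ ⟨,⟩-scaleˡ a Y≈aX ⟩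
      a K.* ⟨ X , g j ⟩  ≈⟨ K.*-congˡ (πx≈⟨X,g⟩ j) ⟨
      a K.* π x j       ≈⟨ π-· a x j ⟨
      π (ι a E.* x) j   ∎
    where open import Relation.Binary.Reasoning.Setoid K.setoid

open import Data.Nat using (_+_; _*_; _∸_; _<_; _≤_; z≤n)
open import Data.Nat.Properties
  using (+-*-semiring; +-mono-≤; <⇒≱; *-monoʳ-≤; *-comm; *-zeroʳ; *-identityʳ; module ≤-Reasoning)
open import Algebra.Properties.Semiring.Sum +-*-semiring
  using (sum; sum-cong-≋; ∑-comm; *-distribˡ-sum; sum-remove)

sum-mono-≤ : ∀ {n} {f g : Vector ℕ n} → (∀ i → f i ≤ g i) → sum f ≤ sum g
sum-mono-≤ {zero}  _   = z≤n
sum-mono-≤ {suc n} f≤g = +-mono-≤ (f≤g zero) (sum-mono-≤ (f≤g ∘ suc))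

sum-const : ∀ n c → sum {n} (λ _ → c) ≡ n * c
sum-const zero    c = ≡.refl
sum-const (suc n) c = ≡.cong (c +_) (sum-const n c)

sum-indicator-except : ∀ {n} (k₀ : Fin n) (f : Vector ℕ n) →
                       f k₀ ≡ 0 → (∀ k → k ≢ k₀ → f k ≡ 1) → sum f ≡ n ∸ 1
sum-indicator-except {suc n} k₀ f fk₀≡0 f≡1 = begin
  sum f                       ≡⟨ sum-remove {i = k₀} f ⟩
  f k₀ + sum (removeAt f k₀)  ≡⟨ ≡.cong₂ _+_ fk₀≡0 (sum-cong-≋ (λ i → f≡1 _ (punchInᵢ≢i k₀ i))) ⟩
  sum {n} (λ _ → 1)           ≡⟨ sum-const n 1 ⟩
  n * 1                       ≡⟨ *-identityʳ n ⟩
  n                           ∎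
  where open ≡.≡-Reasoning

𝟙 : ∀ {p} {P : Set p} → Dec P → ℕ
𝟙 (true  because _) = 1
𝟙 (false because _) = 0

length-filter≡sum-𝟙 : ∀ {a p} {A : Set a} {P : Pred A p} (P? : U.Decidable P) {n} (f : Fin n → A) →
                      length (filter P? (tabulate f)) ≡ sum (λ i → 𝟙 (P? (f i)))
length-filter≡sum-𝟙 P? {zero}  f = ≡.refl
length-filter≡sum-𝟙 P? {suc n} f with P? (f zero)
... | true  because _ = ≡.cong suc (length-filter≡sum-𝟙 P? (f ∘ suc))
... | false because _ = length-filter≡sum-𝟙 P? (f ∘ suc)

module Counting {K E : Field} {q h : ℕ} (size : HasSize K q) (ext : Extension K E h)
                (_≟_ : Decidable (Field._≈_ E)) where
  open Extension ext
  open HasSize size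
  open Hamming E _≟_ using (wt)
  open FieldProperties E using (x∙y⁻¹≈ε⇒x≈y; x≈y⇒x∙y⁻¹≈ε; -1*x≈-x; x≉0∧x*y≈0⇒y≈0; difference-of-multiples)
  open RingMorphisms (CommutativeRing.rawRing K.commutativeRing)
                     (CommutativeRing.rawRing E.commutativeRing)
  open IsRingHomomorphism ι-hom using (⟦⟧-cong)

  nz : E.Carrier → ℕ
  nz x = 𝟙 (¬? (x ≟ E.0#))

  nz-zero : ∀ {x} → x E.≈ E.0# → nz x ≡ 0
  nz-zero {x} x≈0 with x ≟ E.0#
  ... | yes _   = ≡.refl
  ... | no x≉0 = ⊥-elim (x≉0 x≈0)

  nz-nonzero : ∀ {x} → x E.≉ E.0# → nz x ≡ 1
  nz-nonzero {x} x≉0 with x ≟ E.0#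
  ... | yes x≈0 = ⊥-elim (x≉0 x≈0)
  ... | no _    = ≡.refl

  wt≡sum-nz : ∀ {N} (c : Word E (Fin N)) → wt c ≡ sum (λ i → nz (c i))
  wt≡sum-nz c = length-filter≡sum-𝟙 (λ i → ¬? (c i ≟ E.0#)) (λ i → i)

  module _ {a x y} (y≈ιa*x : y E.≈ ι a E.* x) where

    ≈a⇒difference≈0 : ∀ {b} → b K.≈ a → ι b E.* x E.- y E.≈ E.0#
    ≈a⇒difference≈0 b≈a = E.trans (difference-of-multiples y≈ιa*x)
                            (E.trans (E.*-congʳ (x≈y⇒x∙y⁻¹≈ε (⟦⟧-cong b≈a))) (E.zeroˡ x))

    difference≈0⇒≈a : ∀ {b} → x E.≉ E.0# → ι b E.* x E.- y E.≈ E.0# → b K.≈ a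
    difference≈0⇒≈a {b} x≉0 diff≈0 =
      ι-injective ext (finite⇒≈-decidable size) (x∙y⁻¹≈ε⇒x≈y (ι b) (ι a) (x≉0∧x*y≈0⇒y≈0 x≉0
        (E.trans (E.*-comm x (ι b E.- ι a)) (E.trans (E.sym (difference-of-multiples y≈ιa*x)) diff≈0))))

  column-count : ∀ {x y} a → y E.≈ ι a E.* x →
                 sum (λ k → nz (ι (enum k) E.* x E.- y)) ≡ (q ∸ 1) * nz x
  column-count {x} {y} a y≈ιa*x with x ≟ E.0#
  ... | yes x≈0 = begin
    sum (λ k → nz (ι (enum k) E.* x E.- y))
      ≡⟨ sum-cong-≋ {q} (λ k → nz-zero (E.trans (difference-of-multiples y≈ιa*x)
                                          (E.trans (E.*-congˡ x≈0) (E.zeroʳ _)))) ⟩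
    sum {q} (λ _ → 0)  ≡⟨ sum-const q 0 ⟩
    q * 0              ≡⟨ *-zeroʳ q ⟩
    0                  ≡⟨ *-zeroʳ (q ∸ 1) ⟨
    (q ∸ 1) * 0        ∎
    where open ≡.≡-Reasoning
  ... | no x≉0 with enum-surj a
  ... | kₐ , kₐ↦a = ≡.trans
    (sum-indicator-except kₐ _ (nz-zero (≈a⇒difference≈0 y≈ιa*x kₐ↦a)) (λ k → nz-nonzero ∘ difference≉0 k))
    (≡.sym (*-identityʳ (q ∸ 1)))
    where
    difference≉0 : ∀ k → k ≢ kₐ → ι (enum k) E.* x E.- y E.≉ E.0#
    difference≉0 k k≢kₐ diff≈0 =
      k≢kₐ (enum-inj k kₐ (K.trans (difference≈0⇒≈a y≈ιa*x x≉0 diff≈0) (K.sym kₐ↦a)))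

  module _ {N : ℕ} {C : Word E (Fin N) → Set} (linear : IsLinearCode E C) where
    open IsLinearCode linear

    difference : Word E (Fin N) → Word E (Fin N) → K.Carrier → Word E (Fin N)
    difference c c' b i = ι b E.* c i E.- c' i

    difference∈C : ∀ {c c'} → C c → C c' → ∀ b → C (difference c c' b)
    difference∈C c∈C c'∈C b =
      resp (λ i → E.+-congˡ (-1*x≈-x _)) (+∈ (·∈ (ι b) c∈C) (·∈ (E.- E.1#) c'∈C))

    sum-wt-differences : ∀ {c c'} → (∀ i → ∃ λ a → c' i E.≈ ι a E.* c i) →
                         sum (λ k → wt (difference c c' (enum k))) ≡ (q ∸ 1) * wt c
    sum-wt-differences {c} {c'} coordinatewise = begin
      sum (λ k → wt (difference c c' (enum k)))
        ≡⟨ sum-cong-≋ {q} (λ k → wt≡sum-nz (difference c c' (enum k))) ⟩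
      sum (λ k → sum (λ i → nz (difference c c' (enum k) i)))
        ≡⟨ ∑-comm (λ k i → nz (difference c c' (enum k) i)) ⟩
      sum (λ i → sum (λ k → nz (difference c c' (enum k) i)))
        ≡⟨ sum-cong-≋ {N} (λ i → column-count _ (proj₂ (coordinatewise i))) ⟩
      sum (λ i → (q ∸ 1) * nz (c i))
        ≡⟨ *-distribˡ-sum (q ∸ 1) (λ i → nz (c i)) ⟨
      (q ∸ 1) * sum (λ i → nz (c i))
        ≡⟨ ≡.cong ((q ∸ 1) *_) (wt≡sum-nz c) ⟨
      (q ∸ 1) * wt c ∎
      where open ≡.≡-Reasoning

    coordinatewise⇒proportional : ∀ {D W} →
      (∀ c → C c → NonZero E c → D ≤ wt c) → (∀ c → C c → wt c ≤ W) → W * (q ∸ 1) < q * D →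
      ∀ {c c'} → C c → C c' → (∀ i → ∃ λ a → c' i E.≈ ι a E.* c i) →
      ∃ λ a → ∀ i → c' i E.≈ ι a E.* c i
    coordinatewise⇒proportional {D} {W} wt-min wt-max W*[q∸1]<q*D {c} {c'} c∈C c'∈C coordinatewise
      with any? (λ k → all? (λ i → difference c c' (enum k) i ≟ E.0#))
    ... | yes (k , diff≈0) = enum k , λ i → E.sym (x∙y⁻¹≈ε⇒x≈y _ _ (diff≈0 i))
    ... | no ¬diff≈0 = ⊥-elim (<⇒≱ W*[q∸1]<q*D (begin
      q * D                                      ≡⟨ sum-const q D ⟨
      sum {q} (λ _ → D)                          ≤⟨ sum-mono-≤ (λ k → wt-min _ (difference∈C c∈C c'∈C (enum k))
                                                                              (difference-nonzero k)) ⟩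
      sum (λ k → wt (difference c c' (enum k)))  ≡⟨ sum-wt-differences coordinatewise ⟩
      (q ∸ 1) * wt c                             ≤⟨ *-monoʳ-≤ (q ∸ 1) (wt-max c c∈C) ⟩
      (q ∸ 1) * W                                ≡⟨ *-comm (q ∸ 1) W ⟩
      W * (q ∸ 1)                                ∎))
      where
      open ≤-Reasoning
      difference-nonzero : ∀ k → NonZero E (difference c c' (enum k))
      difference-nonzero k = ¬∀⟶∃¬ N _ (λ i → difference c c' (enum k) i ≟ E.0#) (¬diff≈0 ∘ (k ,_))

mainTheorem7 : (K E : Field) (q h : ℕ) → HasSize K q → (ext : Extension K E h) →
    (_≟_ : Decidable (Field._≈_ E)) →
    (N : ℕ) (C : Word E (Fin N) → Set) → IsLinearCode E C →
    (D W : ℕ) →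
    (∃ λ c → ∃ λ c' → C c × C c' × (∃ λ i → ¬ (Field._≈_ E (c i) (c' i))) ×
       Hamming.dist E _≟_ c c' ≡ D) →
    (∀ c c' → C c → C c' → (∃ λ i → ¬ (Field._≈_ E (c i) (c' i))) →
       D ≤ Hamming.dist E _≟_ c c') →
    (∃ λ c → C c × Hamming.wt E _≟_ c ≡ W) →
    (∀ c → C c → Hamming.wt E _≟_ c ≤ W) →
    W * (q ∸ 1) < q * D →
    OuterMinimal ext C
-- Only the bounds D ≤ wt and wt ≤ W enter.
mainTheorem7 K E q h size ext _≟_ N C linear D W _ dist-min _ wt-max W*[q∸1]<q*D M g π rep emb
             v v' (c , c∈C , v≈πc) (c' , c'∈C , v'≈πc') _ _ v'⊆v =
  let a , c'≈ιa*c = coordinatewise⇒proportional linear wt-min wt-max W*[q∸1]<q*D c∈C c'∈C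
                      (λ i → π-support-inclusion⇒proportional ext ≟K rep emb (c i) (c' i) (supp i))
  in a , λ (i , j) → begin
    v' (i , j)           ≈⟨ v'≈πc' i j ⟩
    π (c' i) j           ≈⟨ π-resp (c'≈ιa*c i) j ⟩
    π (ι a E.* c i) j    ≈⟨ π-· a (c i) j ⟩
    a K.* π (c i) j      ≈⟨ K.*-congˡ (v≈πc i j) ⟨
    a K.* v (i , j)      ∎
  where
  open Extension ext
  open IsSimplexEmbedding emb
  open Counting size ext _≟_
  open import Relation.Binary.Reasoning.Setoid K.setoid

  ≟K : Decidable K._≈_
  ≟K = finite⇒≈-decidable size

  wt-min : ∀ c → C c → NonZero E c → D ≤ Hamming.wt E _≟_ c
  wt-min c c∈C = dist-min c (λ _ → E.0#) c∈C (IsLinearCode.zero∈ linear)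

  supp : ∀ i j → π (c' i) j K.≉ K.0# → π (c i) j K.≉ K.0#
  supp i j πc'≉0 πc≈0 =
    v'⊆v (i , j) (πc'≉0 ∘ K.trans (K.sym (v'≈πc' i j))) (K.trans (v≈πc i j) πc≈0)
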